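{- Let \(D\) and \(E\) be \(\mathcal V\)-dcpos with Scott continuous maps \(s:D\to E\) and \(r:E\to D\) such that \(r\circ s = \mathrm{id}_D\). If \(\beta : B\to E\) is a small basis for \(E\), then \(r\circ\beta : B\to D\) is a small basis for \(D\).
   Context: We work constructively and predicatively in univalent foundations with universes and propositional truncation. \(\mathcal V\)-small: equivalent to a type in \(\mathcal V\). Directed family: inhabited index and any two indices have (there exists) a common upper index. \(\mathcal V\)-dcpo: poset with suprema of directed families indexed by types in \(\mathcal V\); Scott continuous maps preserve them. Way-below: \(x\ll y\) iff for every directed \(\alpha:I\to D\), \(I:\mathcal V\), with \(y\sqsubseteq\bigsqcup\alpha\) there exists \(i\) with \(x\sqsubseteq\alpha_i\). A small basis for a \(\mathcal V\)-dcpo \(D\) is a map \(\beta:B\to D\) with \(B:\mathcal V\) such that for every \(x:D\) the family \(\Sigma_{b:B}(\beta(b)\ll x)\to D\), \((b,-)\mapsto\beta(b)\), is directed with supremum \(x\), and for all \(x,b\) the proposition \(\beta(b)\ll x\) is \(\mathcal V\)-small. -}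

module Defs where

open import Level using (Level; _⊔_; Setω) renaming (suc to lsuc)
open import Data.Product using (Σ; _×_; _,_; proj₁; proj₂)
open import Relation.Binary.PropositionalEquality using (_≡_)
open import Function.Bundles using (_↔_)

isProp : ∀ {ℓ} → Set ℓ → Set ℓ
isProp A = (x y : A) → x ≡ y

isSet : ∀ {ℓ} → Set ℓ → Set ℓ
isSet A = (x y : A) → isProp (x ≡ y)

record PropTrunc : Setω where
  field
    ∥_∥      : ∀ {ℓ} → Set ℓ → Set ℓ
    ∥∥-isProp : ∀ {ℓ} {A : Set ℓ} → isProp ∥ A ∥
    ∣_∣      : ∀ {ℓ} {A : Set ℓ} → A → ∥ A ∥
    ∥∥-rec   : ∀ {ℓ ℓ'} {A : Set ℓ} {P : Set ℓ'} → isProp P → (A → P) → ∥ A ∥ → P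

module DomainTheory (pt : PropTrunc) (𝓥 : Level) where
  open PropTrunc pt

  is-small : ∀ {ℓ} → Set ℓ → Set (lsuc 𝓥 ⊔ ℓ)
  is-small X = Σ (Set 𝓥) (λ Y → Y ↔ X)

  module PosetNotions {𝓤 𝓣 : Level} {P : Set 𝓤} (_⊑_ : P → P → Set 𝓣) where

    is-directed : ∀ {𝓘} {I : Set 𝓘} → (I → P) → Set (𝓘 ⊔ 𝓣)
    is-directed {I = I} α =
      ∥ I ∥ × ((i j : I) → ∥ Σ I (λ k → (α i ⊑ α k) × (α j ⊑ α k)) ∥)

    is-upperbound : ∀ {𝓘} {I : Set 𝓘} → (I → P) → P → Set (𝓘 ⊔ 𝓣)
    is-upperbound {I = I} α x = (i : I) → α i ⊑ x

    is-sup : ∀ {𝓘} {I : Set 𝓘} → (I → P) → P → Set (𝓤 ⊔ 𝓘 ⊔ 𝓣)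
    is-sup α x = is-upperbound α x × ((y : P) → is-upperbound α y → x ⊑ y)

  record DCPO (𝓤 𝓣 : Level) : Set (lsuc (𝓥 ⊔ 𝓤 ⊔ 𝓣)) where
    field
      ⟨_⟩         : Set 𝓤
      _⊑_         : ⟨_⟩ → ⟨_⟩ → Set 𝓣
      carrier-set : isSet ⟨_⟩
      ⊑-prop      : (x y : ⟨_⟩) → isProp (x ⊑ y)
      ⊑-refl      : (x : ⟨_⟩) → x ⊑ x
      ⊑-trans     : (x y z : ⟨_⟩) → x ⊑ y → y ⊑ z → x ⊑ z
      ⊑-antisym   : (x y : ⟨_⟩) → x ⊑ y → y ⊑ x → x ≡ y
    open PosetNotions _⊑_ public
    field
      ⋁       : {I : Set 𝓥} (α : I → ⟨_⟩) → is-directed α → ⟨_⟩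
      ⋁-is-sup : {I : Set 𝓥} (α : I → ⟨_⟩) (δ : is-directed α) → is-sup α (⋁ α δ)

    _≪_ : ⟨_⟩ → ⟨_⟩ → Set (lsuc 𝓥 ⊔ 𝓤 ⊔ 𝓣)
    x ≪ y = {I : Set 𝓥} (α : I → ⟨_⟩) (δ : is-directed α) →
            y ⊑ ⋁ α δ → ∥ Σ I (λ i → x ⊑ α i) ∥

  open DCPO

  is-continuous : ∀ {𝓤 𝓣 𝓤' 𝓣'} (D : DCPO 𝓤 𝓣) (E : DCPO 𝓤' 𝓣') →
                  (⟨ D ⟩ → ⟨ E ⟩) → Set (lsuc 𝓥 ⊔ 𝓤 ⊔ 𝓣 ⊔ 𝓤' ⊔ 𝓣')
  is-continuous D E f =
    {I : Set 𝓥} (α : I → ⟨ D ⟩) (δ : is-directed D α) →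
    is-sup E (λ i → f (α i)) (f (⋁ D α δ))

  ↡ᴮ : ∀ {𝓤 𝓣} (D : DCPO 𝓤 𝓣) {B : Set 𝓥} (β : B → ⟨ D ⟩) (x : ⟨ D ⟩) →
       Σ B (λ b → _≪_ D (β b) x) → ⟨ D ⟩
  ↡ᴮ D β x p = β (proj₁ p)

  is-small-basis : ∀ {𝓤 𝓣} (D : DCPO 𝓤 𝓣) {B : Set 𝓥} (β : B → ⟨ D ⟩) →
                   Set (lsuc 𝓥 ⊔ 𝓤 ⊔ 𝓣)
  is-small-basis D {B} β =
      ((x : ⟨ D ⟩) → is-directed D (↡ᴮ D β x) × is-sup D (↡ᴮ D β x) x)
    × ((x : ⟨ D ⟩) (b : B) → is-small (_≪_ D (β b) x))

module Submission where

open import Defs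
open import Level using (Level; Lift; lift; _⊔_) renaming (suc to lsuc)
open import Relation.Binary.PropositionalEquality using (_≡_; subst)
open import Axiom.Extensionality.Propositional using (Extensionality; implicit-extensionality)
open import Data.Product using (Σ; _,_; proj₁; proj₂)
open import Data.Bool using (Bool; true; false)
open import Data.Unit using (⊤; tt)
open import Function.Base using (_∘_)
open import Function.Bundles using (_⇔_; mk⇔; mk↔ₛ′; Inverse; Equivalence)

-- Every x : D is the directed supremum of the small family r ∘ β over the basis
-- elements way below s x, and r ∘ s = id turns β b ≪ s x into r (β b) ≪ x.  This
-- family is cofinal in the family of all r (β b) ≪ x, so the latter is directed
-- with supremum x as well.  Smallness of r (β b) ≪ x follows because it is
-- equivalent to r (β b) lying below some member of the small family, and the
-- order of D is small, being reflected by s into the order of E, which is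
-- determined by the (small) basis elements way below.

module SmallBases (pt : PropTrunc) (fe : ∀ {a b} → Extensionality a b) (𝓥 : Level) where
  open PropTrunc pt
  open DomainTheory pt 𝓥
  open DCPO using (⟨_⟩)

  ∥∥-map : ∀ {a b} {A : Set a} {C : Set b} → (A → C) → ∥ A ∥ → ∥ C ∥
  ∥∥-map f = ∥∥-rec ∥∥-isProp (∣_∣ ∘ f)

  ∥∥-bind : ∀ {a b} {A : Set a} {C : Set b} → ∥ A ∥ → (A → ∥ C ∥) → ∥ C ∥
  ∥∥-bind a f = ∥∥-rec ∥∥-isProp f a

  logically-equivalent-props-small : ∀ {ℓ} {X : Set ℓ} (Y : Set 𝓥) →
                                     isProp X → isProp Y → (Y → X) → (X → Y) → is-small X
  logically-equivalent-props-small Y X-prop Y-prop f g =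
    Y , mk↔ₛ′ f g (λ _ → X-prop _ _) (λ _ → Y-prop _ _)

  module _ {𝓤 𝓣 : Level} (D : DCPO 𝓤 𝓣) where
    open DCPO D

    ≪⇒⊑ : ∀ {x y} → x ≪ y → x ⊑ y
    ≪⇒⊑ {x} {y} x≪y = ∥∥-rec (⊑-prop x y) proj₂ (x≪y (λ _ → y) δ (proj₁ (⋁-is-sup _ δ) (lift tt)))
      where
      δ : is-directed {I = Lift 𝓥 ⊤} (λ _ → y)
      δ = ∣ lift tt ∣ , λ _ _ → ∣ lift tt , ⊑-refl y , ⊑-refl y ∣

    ⊑-≪-trans : ∀ {x y z} → x ⊑ y → y ≪ z → x ≪ z
    ⊑-≪-trans x⊑y y≪z α δ z⊑⋁ = ∥∥-map (λ (i , y⊑αi) → i , ⊑-trans _ _ _ x⊑y y⊑αi) (y≪z α δ z⊑⋁)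

    ≪-⊑-trans : ∀ {x y z} → x ≪ y → y ⊑ z → x ≪ z
    ≪-⊑-trans x≪y y⊑z α δ z⊑⋁ = x≪y α δ (⊑-trans _ _ _ y⊑z z⊑⋁)

    ≪-isProp : ∀ {x y} → isProp (x ≪ y)
    ≪-isProp _ _ = implicit-extensionality fe (fe λ _ → fe λ _ → fe λ _ → ∥∥-isProp _ _)

    ⋁-unique : {I : Set 𝓥} {α : I → ⟨ D ⟩} (δ : is-directed α) {x : ⟨ D ⟩} →
               is-sup α x → ⋁ α δ ≡ x
    ⋁-unique {α = α} δ {x} (x-ub , x-least) =
      ⊑-antisym _ _ (proj₂ (⋁-is-sup α δ) x x-ub) (x-least _ (proj₁ (⋁-is-sup α δ)))

    ≪-directed-sup : {I : Set 𝓥} {α : I → ⟨ D ⟩} {x y : ⟨ D ⟩} →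
                     is-directed α → is-sup α x → y ≪ x → ∥ Σ I (λ i → y ⊑ α i) ∥
    ≪-directed-sup {α = α} δ (_ , x-least) y≪x = y≪x α δ (x-least _ (proj₁ (⋁-is-sup α δ)))

    is-cofinal : ∀ {𝓘 𝓙} {I : Set 𝓘} {J : Set 𝓙} → (J → ⟨ D ⟩) → (I → J) → Set (𝓘 ⊔ 𝓙 ⊔ 𝓣)
    is-cofinal {I = I} {J} α f = (j : J) → ∥ Σ I (λ i → α j ⊑ α (f i)) ∥

    module _ {𝓘 𝓙} {I : Set 𝓘} {J : Set 𝓙} {α : J → ⟨ D ⟩} (f : I → J)
             (cofinal : is-cofinal α f) where

      cofinal-preserves-directed : is-directed α → is-directed (α ∘ f)
      cofinal-preserves-directed (inhabited , bounded) =
          ∥∥-bind inhabited (∥∥-map proj₁ ∘ cofinal)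
        , λ i i' → ∥∥-bind (bounded (f i) (f i')) λ (k , ik , i'k) →
            ∥∥-map (λ (l , kl) → l , ⊑-trans _ _ _ ik kl , ⊑-trans _ _ _ i'k kl) (cofinal k)

      cofinal-reflects-directed : is-directed (α ∘ f) → is-directed α
      cofinal-reflects-directed (inhabited , bounded) =
          ∥∥-map f inhabited
        , λ j j' → ∥∥-bind (cofinal j) λ (i , ji) → ∥∥-bind (cofinal j') λ (i' , j'i') →
            ∥∥-map (λ (k , ik , i'k) → f k , ⊑-trans _ _ _ ji ik , ⊑-trans _ _ _ j'i' i'k)
                   (bounded i i')

      cofinal-bounded : ∀ {y} → is-upperbound (α ∘ f) y → is-upperbound α y
      cofinal-bounded f-ub j = ∥∥-rec (⊑-prop _ _) (λ (i , ji) → ⊑-trans _ _ _ ji (f-ub i)) (cofinal j)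

      cofinal-preserves-sup : ∀ {x} → is-sup α x → is-sup (α ∘ f) x
      cofinal-preserves-sup (ub , least) = ub ∘ f , λ y y-ub → least y (cofinal-bounded y-ub)

      cofinal-reflects-sup : ∀ {x} → is-sup (α ∘ f) x → is-sup α x
      cofinal-reflects-sup (ub , least) = cofinal-bounded ub , λ y y-ub → least y (y-ub ∘ f)

    -- Only a logical equivalence with a small relation: the small copies are
    -- always truncated before use, so no inverse laws are needed.
    is-locally-small : Set (lsuc 𝓥 ⊔ 𝓤 ⊔ 𝓣)
    is-locally-small = Σ (⟨ D ⟩ → ⟨ D ⟩ → Set 𝓥) (λ _⊑ₛ_ → ∀ x y → (x ⊑ₛ y) ⇔ (x ⊑ y))

    record SmallApproximation {B : Set 𝓥} (β : B → ⟨ D ⟩) (x : ⟨ D ⟩) : Set (lsuc 𝓥 ⊔ 𝓤 ⊔ 𝓣) where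
      field
        index       : Set 𝓥
        approximant : index → Σ B (λ b → β b ≪ x)
        directed    : is-directed (↡ᴮ D β x ∘ approximant)
        sup         : is-sup (↡ᴮ D β x ∘ approximant) x

    open SmallApproximation

    module _ {B : Set 𝓥} {β : B → ⟨ D ⟩} where

      approximation-cofinal : ∀ {x} (a : SmallApproximation β x) → is-cofinal (↡ᴮ D β x) (approximant a)
      approximation-cofinal a (_ , b≪x) = ≪-directed-sup (directed a) (sup a) b≪x

      small-basis-from-approximations : is-locally-small → ((x : ⟨ D ⟩) → SmallApproximation β x) →
                                        is-small-basis D β
      small-basis-from-approximations (_⊑ₛ_ , ⊑ₛ⇔⊑) approx =
          (λ x → cofinal-reflects-directed (approximant (approx x)) (cofinal x) (directed (approx x))
               , cofinal-reflects-sup (approximant (approx x)) (cofinal x) (sup (approx x)))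
        , λ x b → logically-equivalent-props-small
            ∥ Σ (index (approx x)) (λ i → β b ⊑ₛ ↡ᴮ D β x (approximant (approx x) i)) ∥
            ≪-isProp ∥∥-isProp
            (∥∥-rec ≪-isProp λ (i , le) →
              ⊑-≪-trans (Equivalence.to (⊑ₛ⇔⊑ _ _) le) (proj₂ (approximant (approx x) i)))
            (λ b≪x → ∥∥-map (λ (i , le) → i , Equivalence.from (⊑ₛ⇔⊑ _ _) le) (cofinal x (b , b≪x)))
        where
        cofinal : (x : ⟨ D ⟩) → is-cofinal (↡ᴮ D β x) (approximant (approx x))
        cofinal x = approximation-cofinal (approx x)

      module _ (basis : is-small-basis D β) where
        private
          _≪ₛ_ : B → ⟨ D ⟩ → Set 𝓥
          b ≪ₛ x = proj₁ (proj₂ basis x b)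

          ≪ₛ⇒≪ : ∀ {b x} → b ≪ₛ x → β b ≪ x
          ≪ₛ⇒≪ {b} {x} = Inverse.to (proj₂ (proj₂ basis x b))

          ≪⇒≪ₛ : ∀ {b x} → β b ≪ x → b ≪ₛ x
          ≪⇒≪ₛ {b} {x} = Inverse.from (proj₂ (proj₂ basis x b))

        small-basis⇒locally-small : is-locally-small
        small-basis⇒locally-small =
            (λ x y → (b : B) → b ≪ₛ x → b ≪ₛ y)
          , λ x y → mk⇔
              (λ ≪ₛ-mono → proj₂ (proj₂ (proj₁ basis x)) y λ (b , b≪x) →
                 ≪⇒⊑ (≪ₛ⇒≪ (≪ₛ-mono b (≪⇒≪ₛ b≪x))))
              (λ x⊑y b b≪ₛx → ≪⇒≪ₛ (≪-⊑-trans (≪ₛ⇒≪ b≪ₛx) x⊑y))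

        small-basis⇒approximation : (x : ⟨ D ⟩) → SmallApproximation β x
        small-basis⇒approximation x = record
          { index       = Σ B (_≪ₛ x)
          ; approximant = approximant′
          ; directed    = cofinal-preserves-directed approximant′ cofinal (proj₁ (proj₁ basis x))
          ; sup         = cofinal-preserves-sup approximant′ cofinal (proj₂ (proj₁ basis x))
          }
          where
          approximant′ : Σ B (_≪ₛ x) → Σ B (λ b → β b ≪ x)
          approximant′ (b , b≪ₛx) = b , ≪ₛ⇒≪ b≪ₛx

          cofinal : is-cofinal (↡ᴮ D β x) approximant′
          cofinal (b , b≪x) = ∣ (b , ≪⇒≪ₛ b≪x) , ⊑-refl (β b) ∣

  module _ {𝓤 𝓣 𝓤' 𝓣' : Level} (D : DCPO 𝓤 𝓣) (E : DCPO 𝓤' 𝓣') where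
    private
      module D = DCPO D
      module E = DCPO E

    is-monotone : (⟨ D ⟩ → ⟨ E ⟩) → Set (𝓤 ⊔ 𝓣 ⊔ 𝓣')
    is-monotone f = ∀ {x y} → x D.⊑ y → f x E.⊑ f y

    continuous⇒monotone : {f : ⟨ D ⟩ → ⟨ E ⟩} → is-continuous D E f → is-monotone f
    continuous⇒monotone {f} f-cont {x} {y} x⊑y =
      subst (λ z → f x E.⊑ f z) (⋁-unique D δ (ub , λ _ z-ub → z-ub (lift false)))
            (proj₁ (f-cont α δ) (lift true))
      where
      α : Lift 𝓥 Bool → ⟨ D ⟩
      α (lift true)  = x
      α (lift false) = y
      ub : D.is-upperbound α y
      ub (lift true)  = x⊑y
      ub (lift false) = D.⊑-refl y
      δ : D.is-directed α
      δ = ∣ lift true ∣ , λ i j → ∣ lift false , ub i , ub j ∣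

    monotone-image-directed : ∀ {𝓘} {I : Set 𝓘} {f : ⟨ D ⟩ → ⟨ E ⟩} {α : I → ⟨ D ⟩} →
                              is-monotone f → D.is-directed α → E.is-directed (f ∘ α)
    monotone-image-directed f-mono (inhabited , bounded) =
      inhabited , λ i j → ∥∥-map (λ (k , ik , jk) → k , f-mono ik , f-mono jk) (bounded i j)

    continuous-preserves-sup : (f : ⟨ D ⟩ → ⟨ E ⟩) {I : Set 𝓥} {α : I → ⟨ D ⟩} {x : ⟨ D ⟩} →
                               is-continuous D E f → D.is-directed α → D.is-sup α x →
                               E.is-sup (f ∘ α) (f x)
    continuous-preserves-sup f {α = α} f-cont δ x-sup =
      subst (λ z → E.is-sup (f ∘ α) (f z)) (⋁-unique D δ x-sup) (f-cont α δ)

  module _ {𝓤 𝓣 𝓤' 𝓣' : Level} {D : DCPO 𝓤 𝓣} {E : DCPO 𝓤' 𝓣'}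
           (s : ⟨ D ⟩ → ⟨ E ⟩) (r : ⟨ E ⟩ → ⟨ D ⟩)
           (s-cont : is-continuous D E s) (r-cont : is-continuous E D r)
           (r∘s≡id : (x : ⟨ D ⟩) → r (s x) ≡ x) where
    private
      module D = DCPO D
      module E = DCPO E

      s-mono : is-monotone D E s
      s-mono = continuous⇒monotone D E s-cont

      r-mono : is-monotone E D r
      r-mono = continuous⇒monotone E D r-cont

    retract-locally-small : is-locally-small E → is-locally-small D
    retract-locally-small (_⊑ₛ_ , ⊑ₛ⇔⊑) =
        (λ u v → s u ⊑ₛ s v)
      , λ u v → mk⇔
          (λ su⊑ₛsv → cancel-r∘s (r-mono (Equivalence.to (⊑ₛ⇔⊑ _ _) su⊑ₛsv)))
          (Equivalence.from (⊑ₛ⇔⊑ _ _) ∘ s-mono)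
      where
      cancel-r∘s : ∀ {u v} → r (s u) D.⊑ r (s v) → u D.⊑ v
      cancel-r∘s {u} {v} = subst (D._⊑ v) (r∘s≡id u) ∘ subst (r (s u) D.⊑_) (r∘s≡id v)

    retraction-≪ : ∀ {y x} → y E.≪ s x → r y D.≪ x
    retraction-≪ {y} {x} y≪sx α δ x⊑⋁α =
      ∥∥-map (λ (i , y⊑sαi) → i , subst (r y D.⊑_) (r∘s≡id (α i)) (r-mono y⊑sαi))
             (y≪sx (s ∘ α) sδ (E.⊑-trans _ _ _ (s-mono x⊑⋁α) s⋁α⊑⋁sα))
      where
      sδ : E.is-directed (s ∘ α)
      sδ = monotone-image-directed D E s-mono δ
      s⋁α⊑⋁sα : s (D.⋁ α δ) E.⊑ E.⋁ (s ∘ α) sδ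
      s⋁α⊑⋁sα = proj₂ (s-cont α δ) _ (proj₁ (E.⋁-is-sup (s ∘ α) sδ))

    retract-approximation : {B : Set 𝓥} {β : B → ⟨ E ⟩} {x : ⟨ D ⟩} →
                            SmallApproximation E β (s x) → SmallApproximation D (r ∘ β) x
    retract-approximation {x = x} a = record
      { index       = index
      ; approximant = λ i → proj₁ (approximant i) , retraction-≪ (proj₂ (approximant i))
      ; directed    = monotone-image-directed E D r-mono directed
      ; sup         = subst (D.is-sup _) (r∘s≡id x) (continuous-preserves-sup E D r r-cont directed sup)
      }
      where open SmallApproximation a

    small-basis-retract : {B : Set 𝓥} {β : B → ⟨ E ⟩} →
                          is-small-basis E β → is-small-basis D (r ∘ β)
    small-basis-retract basis =
      small-basis-from-approximations D
        (retract-locally-small (small-basis⇒locally-small E basis))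
        (λ x → retract-approximation (small-basis⇒approximation E basis (s x)))

theorem5p10 : (pt : PropTrunc) (fe : ∀ {a b} → Extensionality a b) (𝓥 : Level)
              {𝓤 𝓣 𝓤' 𝓣' : Level}
              (D : DomainTheory.DCPO pt 𝓥 𝓤 𝓣) (E : DomainTheory.DCPO pt 𝓥 𝓤' 𝓣')
              (s : DomainTheory.DCPO.⟨_⟩ D → DomainTheory.DCPO.⟨_⟩ E)
              (r : DomainTheory.DCPO.⟨_⟩ E → DomainTheory.DCPO.⟨_⟩ D) →
              DomainTheory.is-continuous pt 𝓥 D E s →
              DomainTheory.is-continuous pt 𝓥 E D r →
              ((x : DomainTheory.DCPO.⟨_⟩ D) → r (s x) ≡ x) →
              {B : Set 𝓥} (β : B → DomainTheory.DCPO.⟨_⟩ E) →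
              DomainTheory.is-small-basis pt 𝓥 E β →
              DomainTheory.is-small-basis pt 𝓥 D (λ b → r (β b))
theorem5p10 pt fe 𝓥 D E s r s-cont r-cont r∘s≡id β =
  SmallBases.small-basis-retract pt fe 𝓥 {D = D} {E} s r s-cont r-cont r∘s≡id {β = β}
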